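{- Let $\mathbf k$ be a field, let $\mathcal H$ be a finite arrangement of linear hyperplanes in $\mathbf k^n$, and let $\mathcal A$ be a subspace arrangement embedded in $\mathcal H$, i.e. an antichain in the intersection lattice $L_{\mathcal H}$. If the blocker ideal equals the vanishing ideal, $\mathcal B_{\mathcal A,\mathcal H}=\mathcal I_{\mathcal A}$, then $\mathcal A$, viewed as an antichain in $L_{\mathcal H}$, has the Turán property.
   Context: The intersection lattice $L_{\mathcal H}$ is the set of all intersections of subfamilies of $\mathcal H$ (the empty intersection being $\mathbf k^n$), ordered by reverse inclusion; its bottom is $\mathbf k^n$, its top is $\bigcap\mathcal H$, and its atoms are the hyperplanes of $\mathcal H$. For $x\in L_{\mathcal H}$, $\Lambda(x)$ is the set of hyperplanes $H\in\mathcal H$ containing $x$, and $\Lambda=\mathcal H$. An antichain in $L_{\mathcal H}$ is a nonempty set of pairwise incomparable elements not containing $\mathbf k^n$. The blocker of an antichain $A$ is $A^*=\min\{x\in L_{\mathcal H}:\Lambda(x)\cap\Lambda(a)\neq\emptyset\ \forall a\in A\}$ ($\min$ = set of minimal elements). For $H\in\mathcal H$, $\ell_H$ is a linear form defining $H$. The vanishing ideal $\mathcal I_{\mathcal A}\subseteq\mathbf k[x_1,\dots,x_n]$ is the ideal of polynomials vanishing identically on every subspace in $\mathcal A$. The blocker ideal is $\mathcal B_{\mathcal A,\mathcal H}=\langle \prod_{H\in\Lambda(B)}\ell_H : B\in\mathcal A^*\rangle$. A set $S\subseteq\Lambda$ of atoms is $\mathcal A$-intersecting if $S\cap\Lambda(a)\neq\emptyset$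 for all $a\in\mathcal A$. An antichain $\mathcal A$ has the Turán property if the smallest cardinality of an $\mathcal A$-intersecting atom set equals $\min\{|\Lambda(b)|: b\in\mathcal A^*\}$. -}

module Defs where

open import Level using (Level; _⊔_)
open import Algebra.Bundles using (CommutativeRing)
open import Data.Nat as ℕ using (ℕ; zero; suc; _≤_)
open import Data.Fin as Fin using (Fin)
open import Data.Vec as Vec using (Vec; []; _∷_)
import Data.Vec.Properties as VecP
open import Data.Bool using (Bool; true; false; if_then_else_)
open import Data.List as List using (List; []; _∷_; _++_)
open import Data.List.Relation.Unary.All using (All)
import Data.List.Membership.Propositional as LMem
open import Data.Fin.Subset using (Subset; _∈_; _⊆_; ∣_∣)
open import Data.Product using (Σ; ∃; _×_; _,_; proj₁; proj₂)
open import Relation.Nullary using (¬_; does)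
open import Relation.Binary.PropositionalEquality using (_≡_)

record Field (c ℓ : Level) : Set (Level.suc (c ⊔ ℓ)) where
  field
    commutativeRing : CommutativeRing c ℓ
  open CommutativeRing commutativeRing public
  field
    0≉1     : ¬ (0# ≈ 1#)
    inverse : ∀ x → ¬ (x ≈ 0#) → Σ Carrier λ y → x * y ≈ 1#

module _ {c l : Level} (F : Field c l) where
  open Field F using (Carrier; _≈_; _+_; _*_; 0#; 1#)

  -- vectors of kⁿ / linear forms on kⁿ (coefficient vectors)
  dot : ∀ {n} → Vec Carrier n → Vec Carrier n → Carrier
  dot []       []       = 0#
  dot (a ∷ as) (v ∷ vs) = a * v + dot as vs

  -- Polynomials in n variables x₁,…,xₙ over k, as finite formal sums of
  -- terms  c · x^e  (e an exponent vector).  Two polynomials are equal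
  -- iff all their coefficients agree.

  Monomial : ℕ → Set
  Monomial n = Vec ℕ n

  Poly : ℕ → Set c
  Poly n = List (Carrier × Monomial n)

  coeff : ∀ {n} → Poly n → Monomial n → Carrier
  coeff []             e = 0#
  coeff ((a , f) ∷ ts) e =
    (if does (VecP.≡-dec ℕ._≟_ f e) then a else 0#) + coeff ts e

  _≈P_ : ∀ {n} → Poly n → Poly n → Set l
  p ≈P q = ∀ e → coeff p e ≈ coeff q e

  0P : ∀ {n} → Poly n
  0P = []

  1P : ∀ {n} → Poly n
  1P {n} = (1# , Vec.replicate n 0) ∷ []

  _+P_ : ∀ {n} → Poly n → Poly n → Poly n
  p +P q = p ++ q

  _*P_ : ∀ {n} → Poly n → Poly n → Poly n
  p *P q = List.concatMap
             (λ t → List.map (λ u → (proj₁ t * proj₁ u ,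
                                      Vec.zipWith ℕ._+_ (proj₂ t) (proj₂ u))) q) p

  powK : Carrier → ℕ → Carrier
  powK x zero    = 1#
  powK x (suc k) = x * powK x k

  evalMono : ∀ {n} → Monomial n → Vec Carrier n → Carrier
  evalMono []       []       = 1#
  evalMono (e ∷ es) (v ∷ vs) = powK v e * evalMono es vs

  eval : ∀ {n} → Poly n → Vec Carrier n → Carrier
  eval []             v = 0#
  eval ((a , e) ∷ ts) v = a * evalMono e v + eval ts v

  linPoly : ∀ {n} → Vec Carrier n → Poly n
  linPoly {n} a = Vec.toList (Vec.zipWith (λ aᵢ i → (aᵢ , unit i)) a (Vec.allFin n))
    where
    unit : Fin n → Monomial n
    unit i = Vec.updateAt (Vec.replicate n 0) i (λ _ → 1)

  prodOver : ∀ {n m} → (Fin m → Poly n) → Subset m → Poly n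
  prodOver f []           = 1P
  prodOver f (true  ∷ s)  = f Fin.zero *P prodOver (λ i → f (Fin.suc i)) s
  prodOver f (false ∷ s)  = prodOver (λ i → f (Fin.suc i)) s

  InIdealGen : ∀ {n m} {p} → (Subset m → Set p) → (Subset m → Poly n)
               → Poly n → Set (c ⊔ l ⊔ p)
  InIdealGen {n} {m} G g f =
    Σ (List (Poly n × Subset m)) λ cs →
      All (λ t → G (proj₂ t)) cs ×
      (f ≈P List.foldr (λ t acc → (proj₁ t *P g (proj₂ t)) +P acc) 0P cs)

  -- Hyperplane arrangement given by the forms ℓ : Fin m → kⁿ.
  module Arr {n m : ℕ} (ℓ : Fin m → Vec Carrier n) where

    OnHyp : Fin m → Vec Carrier n → Set l
    OnHyp i v = dot (ℓ i) v ≈ 0#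

    IsArrangement : Set (c ⊔ l)
    IsArrangement =
      (∀ i → Σ (Fin n) λ j → ¬ (Vec.lookup (ℓ i) j ≈ 0#)) ×
      (∀ i j → ¬ (i ≡ j) →
         ¬ (∀ v → (OnHyp i v → OnHyp j v) × (OnHyp j v → OnHyp i v)))

    Pt : Subset m → Vec Carrier n → Set l
    Pt S v = ∀ i → i ∈ S → OnHyp i v

    -- Elements x of L_𝓗 are represented by Λ(x) ⊆ 𝓗 (a bijection):
    -- S is Λ(x) for the flat x = ⋂ S iff every hyperplane containing
    -- ⋂ S already lies in S.
    IsFlat : Subset m → Set (c ⊔ l)
    IsFlat S = ∀ i → (∀ v → Pt S v → OnHyp i v) → i ∈ S

    -- x ≤ y in L_𝓗 (reverse inclusion)  ⇔  Λ(x) ⊆ Λ(y)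
    _≤L_ : Subset m → Subset m → Set
    S ≤L T = S ⊆ T

    IsBottom : Subset m → Set (c ⊔ l)
    IsBottom S = ∀ v → Pt S v

    open LMem using () renaming (_∈_ to _∈L_)

    IsAntichain : List (Subset m) → Set (c ⊔ l)
    IsAntichain 𝒜 =
      ¬ (𝒜 ≡ []) ×
      (∀ a → a ∈L 𝒜 → IsFlat a) ×
      (∀ a → a ∈L 𝒜 → ¬ IsBottom a) ×
      (∀ a b → a ∈L 𝒜 → b ∈L 𝒜 → a ≤L b → a ≡ b)

    Intersecting : List (Subset m) → Subset m → Set
    Intersecting 𝒜 S = ∀ a → a ∈L 𝒜 → ∃ λ i → i ∈ S × i ∈ a

    InBlocker : List (Subset m) → Subset m → Set (c ⊔ l)
    InBlocker 𝒜 S =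
      IsFlat S × Intersecting 𝒜 S ×
      (∀ T → IsFlat T → Intersecting 𝒜 T → T ≤L S → T ≡ S)

    InBlockerIdeal : List (Subset m) → Poly n → Set (c ⊔ l)
    InBlockerIdeal 𝒜 = InIdealGen (InBlocker 𝒜) (prodOver (λ i → linPoly (ℓ i)))

    InVanishingIdeal : List (Subset m) → Poly n → Set (c ⊔ l)
    InVanishingIdeal 𝒜 f = ∀ a → a ∈L 𝒜 → ∀ v → Pt a v → eval f v ≈ 0#

    BlockerIdealEqVanishing : List (Subset m) → Set (c ⊔ l)
    BlockerIdealEqVanishing 𝒜 =
      ∀ f → (InBlockerIdeal 𝒜 f → InVanishingIdeal 𝒜 f) ×
            (InVanishingIdeal 𝒜 f → InBlockerIdeal 𝒜 f)

    IsMinCard : ∀ {p} → (Subset m → Set p) → ℕ → Set p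
    IsMinCard P k = (∃ λ S → P S × ∣ S ∣ ≡ k) × (∀ S → P S → k ≤ ∣ S ∣)

    Turan : List (Subset m) → Set (c ⊔ l)
    Turan 𝒜 = ∃ λ k → IsMinCard (Intersecting 𝒜) k × IsMinCard (InBlocker 𝒜) k

{-# OPTIONS --safe #-}

-- Let S be a smallest set of hyperplanes meeting Λ(a) for every a ∈ 𝒜. The product of the
-- forms ℓ_H, H ∈ S, vanishes on every member of 𝒜, so by 𝓑 = 𝓘 it equals a combination
-- Σ pₖ ∏_{H ∈ Bₖ} ℓ_H with blockers Bₖ. Blockers meet every Λ(a), hence |Bₖ| ≥ |S|. If every
-- |Bₖ| exceeded |S|, all monomials on the right would have degree > |S|, while the left side
-- is homogeneous of degree |S| and nonzero. Nonzeroness comes from lexicographically leading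
-- monomials, whose coefficients multiply; evaluation would not do, since over a finite field a
-- nonzero product of linear forms can vanish everywhere. So some blocker has exactly |S|
-- hyperplanes, which is the Turán property.

module Submission where

open import Defs using (Field; Monomial; Poly; module Arr)
import Defs
open import Level using (Level; _⊔_)
open import Function using (_∘_; _$_)
open import Data.Unit using (tt)
open import Data.Nat as ℕ using (ℕ; zero; suc; _<_; _≤_)
import Data.Nat.Properties as ℕP
open import Data.Nat.Induction using (<-wellFounded)
import Algebra.Properties.CommutativeSemigroup as CommutativeSemigroupProperties
open import Data.Product using (∃; _×_; _,_; proj₁; proj₂; map₂)
open import Data.Sum using (_⊎_; inj₁; inj₂)
open import Data.Fin as Fin using (Fin)
open import Data.Fin.Properties using (any?)
open import Data.Fin.Subset using (Subset; _∈_; ⊤; ∣_∣; inside; outside)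
open import Data.Fin.Subset.Properties using (_∈?_; ∈⊤; anySubset?)
open import Data.Vec as Vec using (Vec; []; _∷_; here; there)
import Data.Vec.Properties as VecP
import Data.Vec.Relation.Binary.Pointwise.Inductive as Pointwise
open import Data.Vec.Relation.Binary.Lex.Strict using (Lex-≤; base; this; next; ≤-refl)
open import Data.Bool using (if_then_else_)
open import Data.List as List using (List; []; _∷_; _++_)
open import Data.List.Relation.Unary.All as All using (All; []; _∷_)
import Data.List.Relation.Unary.All.Properties as AllP
import Data.List.Membership.Propositional as ListMembership
open import Relation.Nullary using (¬_; does; Dec; yes; no)
open import Relation.Nullary.Decidable using (dec-true; dec-false; decidable-stable; ¬¬-excluded-middle; _×-dec_; map′)
open import Relation.Nullary.Negation using (¬¬-Monad; contradiction)
open import Effect.Monad using (RawMonad)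
open import Relation.Unary using (Pred; Decidable)
open import Relation.Binary.Definitions using (DecidableEquality)
open import Relation.Binary.PropositionalEquality as ≡ using (_≡_; _≢_; cong; cong₂)
import Induction.WellFounded as WF
import Relation.Binary.Construct.On as On

infixl 6 _⊕_
_⊕_ : ∀ {n} → Vec ℕ n → Vec ℕ n → Vec ℕ n
_⊕_ = Vec.zipWith ℕ._+_

deg : ∀ {n} → Vec ℕ n → ℕ
deg = Vec.sum

deg-⊕ : ∀ {n} (e f : Vec ℕ n) → deg (e ⊕ f) ≡ deg e ℕ.+ deg f
deg-⊕ []      []      = ≡.refl
deg-⊕ (x ∷ e) (y ∷ f) =
  ≡.trans (cong (x ℕ.+ y ℕ.+_) (deg-⊕ e f)) (interchange x y (deg e) (deg f))
  where open CommutativeSemigroupProperties ℕP.+-commutativeSemigroup using (interchange)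

deg-0ⁿ : ∀ n → deg (Vec.replicate n 0) ≡ 0
deg-0ⁿ zero    = ≡.refl
deg-0ⁿ (suc n) = deg-0ⁿ n

infix 4 _≤lex_
_≤lex_ : ∀ {n} → Vec ℕ n → Vec ℕ n → Set
_≤lex_ = Lex-≤ _≡_ _<_

≤lex-refl : ∀ {n} (e : Vec ℕ n) → e ≤lex e
≤lex-refl e = ≤-refl (Pointwise.refl ≡.refl)

≤lex-head : ∀ {n x y} {e E : Vec ℕ n} → x ∷ e ≤lex y ∷ E → x ≤ y
≤lex-head (this x<y _)    = ℕP.<⇒≤ x<y
≤lex-head (next ≡.refl _) = ℕP.≤-refl

⊕-mono-≤lex : ∀ {n} {e E f G : Vec ℕ n} → e ≤lex E → f ≤lex G → e ⊕ f ≤lex E ⊕ G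
⊕-mono-≤lex (base _)          (base _)          = base tt
⊕-mono-≤lex {f = _ ∷ _} {_ ∷ _} (this x<y _) f≤G  = this (ℕP.+-mono-<-≤ x<y (≤lex-head f≤G)) ≡.refl
⊕-mono-≤lex (next ≡.refl _)   (this a<b _)      = this (ℕP.+-monoʳ-< _ a<b) ≡.refl
⊕-mono-≤lex (next ≡.refl e≤E) (next ≡.refl f≤G) = next ≡.refl (⊕-mono-≤lex e≤E f≤G)

⊕-≤lex-cancel : ∀ {n} {e E f G : Vec ℕ n} → e ≤lex E → f ≤lex G → e ⊕ f ≡ E ⊕ G → e ≡ E × f ≡ G
⊕-≤lex-cancel (base _)          (base _)          _  = ≡.refl , ≡.refl
⊕-≤lex-cancel {f = _ ∷ _} {_ ∷ _} (this x<y _) f≤G eq =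
  contradiction (ℕP.+-mono-<-≤ x<y (≤lex-head f≤G)) (ℕP.<-irrefl (VecP.∷-injectiveˡ eq))
⊕-≤lex-cancel (next ≡.refl _)   (this a<b _)      eq =
  contradiction (ℕP.+-monoʳ-< _ a<b) (ℕP.<-irrefl (VecP.∷-injectiveˡ eq))
⊕-≤lex-cancel (next ≡.refl e≤E) (next ≡.refl f≤G) eq
  with ⊕-≤lex-cancel e≤E f≤G (VecP.∷-injectiveʳ eq)
... | ≡.refl , ≡.refl = ≡.refl , ≡.refl

IsSmallest : ∀ {m p} → Pred (Subset m) p → Subset m → Set p
IsSmallest P S = P S × (∀ T → P T → ∣ S ∣ ≤ ∣ T ∣)

smallest : ∀ {m p} {P : Pred (Subset m) p} → Decidable P → ∀ {S₀} → P S₀ → ∃ (IsSmallest P)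
smallest {m} {p} {P} P? = WF.All.wfRec (On.wellFounded ∣_∣ <-wellFounded) _ Goal step _
  where
  Goal : Pred (Subset m) p
  Goal S₀ = P S₀ → ∃ (IsSmallest P)
  step : ∀ S → (∀ {T} → ∣ T ∣ < ∣ S ∣ → Goal T) → Goal S
  step S smaller pS with anySubset? (λ T → P? T ×-dec ∣ T ∣ ℕ.<? ∣ S ∣)
  ... | yes (T , pT , ∣T∣<∣S∣) = smaller ∣T∣<∣S∣ pT
  ... | no ∄smaller            = S , pS , λ T pT → ℕP.≮⇒≥ (λ ∣T∣<∣S∣ → ∄smaller (T , pT , ∣T∣<∣S∣))

module Polynomials {c l : Level} (F : Field c l) where
  open Field F
  open import Relation.Binary.Reasoning.Setoid setoid
  open CommutativeSemigroupProperties *-commutativeSemigroup using () renaming (interchange to *-interchange)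
  open RawMonad (¬¬-Monad {c ⊔ l}) using (_>>=_; pure)

  coeff : ∀ {n} → Poly F n → Monomial F n → Carrier
  coeff = Defs.coeff F

  evalMono : ∀ {n} → Monomial F n → Vec Carrier n → Carrier
  evalMono = Defs.evalMono F

  eval : ∀ {n} → Poly F n → Vec Carrier n → Carrier
  eval = Defs.eval F

  infixl 7 _*P_
  _*P_ : ∀ {n} → Poly F n → Poly F n → Poly F n
  _*P_ = Defs._*P_ F

  linPoly : ∀ {n} → Vec Carrier n → Poly F n
  linPoly = Defs.linPoly F

  1P : ∀ {n} → Poly F n
  1P = Defs.1P F

  prodOver : ∀ {n m} → (Fin m → Poly F n) → Subset m → Poly F n
  prodOver = Defs.prodOver F

  infix 4 _≈P_
  _≈P_ : ∀ {n} → Poly F n → Poly F n → Set l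
  _≈P_ = Defs._≈P_ F

  x≈0⇒x*y≈0 : ∀ {x y} → x ≈ 0# → x * y ≈ 0#
  x≈0⇒x*y≈0 {x} {y} x≈0 = trans (*-congʳ x≈0) (zeroˡ y)

  y≈0⇒x*y≈0 : ∀ {x y} → y ≈ 0# → x * y ≈ 0#
  y≈0⇒x*y≈0 {x} {y} y≈0 = trans (*-congˡ y≈0) (zeroʳ x)

  x≉0∧y≉0⇒x*y≉0 : ∀ {x y} → ¬ x ≈ 0# → ¬ y ≈ 0# → ¬ x * y ≈ 0#
  x≉0∧y≉0⇒x*y≉0 {x} {y} x≉0 y≉0 xy≈0 with inverse x x≉0
  ... | x⁻¹ , xx⁻¹≈1 = y≉0 (begin
    y              ≈⟨ *-identityˡ y ⟨
    1# * y         ≈⟨ *-congʳ xx⁻¹≈1 ⟨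
    (x * x⁻¹) * y  ≈⟨ *-congʳ (*-comm x x⁻¹) ⟩
    (x⁻¹ * x) * y  ≈⟨ *-assoc x⁻¹ x y ⟩
    x⁻¹ * (x * y)  ≈⟨ y≈0⇒x*y≈0 xy≈0 ⟩
    0#             ∎)

  Term : ℕ → Set c
  Term n = Carrier × Monomial F n

  infixl 7 _·ₜ_
  _·ₜ_ : ∀ {n} → Term n → Term n → Term n
  t ·ₜ u = proj₁ t * proj₁ u , proj₂ t ⊕ proj₂ u

  _≟ₘ_ : ∀ {n} → DecidableEquality (Monomial F n)
  _≟ₘ_ = VecP.≡-dec ℕ._≟_

  -- coeff (t ∷ p) e reduces to termCoeff t e + coeff p e.
  termCoeff : ∀ {n} → Term n → Monomial F n → Carrier
  termCoeff (a , f) e = if does (f ≟ₘ e) then a else 0#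

  termCoeff-self : ∀ {n} a (e : Monomial F n) → termCoeff (a , e) e ≈ a
  termCoeff-self a e = reflexive (cong (if_then a else 0#) (dec-true (e ≟ₘ e) ≡.refl))

  termCoeff-≢ : ∀ {n} a (f e : Monomial F n) → f ≢ e → termCoeff (a , f) e ≈ 0#
  termCoeff-≢ a f e f≢e = reflexive (cong (if_then a else 0#) (dec-false (f ≟ₘ e) f≢e))

  termCoeff-≈0 : ∀ {n a} (f e : Monomial F n) → a ≈ 0# → termCoeff (a , f) e ≈ 0#
  termCoeff-≈0 f e a≈0 with f ≟ₘ e
  ... | yes _ = a≈0
  ... | no _  = refl

  coeff-++ : ∀ {n} (p q : Poly F n) e → coeff (p ++ q) e ≈ coeff p e + coeff q e
  coeff-++ []      q e = sym (+-identityˡ _)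
  coeff-++ (t ∷ p) q e = trans (+-congˡ (coeff-++ p q e)) (sym (+-assoc _ _ _))

  coeff-absent : ∀ {n} {e : Monomial F n} (p : Poly F n) → All (λ t → proj₂ t ≢ e) p → coeff p e ≈ 0#
  coeff-absent []      []           = refl
  coeff-absent (t ∷ p) (f≢e ∷ p≢e) =
    trans (+-cong (termCoeff-≢ (proj₁ t) (proj₂ t) _ f≢e) (coeff-absent p p≢e)) (+-identityʳ 0#)

  All-*P : ∀ {n p₁ p₂ p₃} {P : Pred (Term n) p₁} {Q : Pred (Term n) p₂} {R : Pred (Term n) p₃}
           {p q} → All P p → All Q q → (∀ {t u} → P t → Q u → R (t ·ₜ u)) → All R (p *P q)
  All-*P []        Qq P·Q⇒R = []
  All-*P (Pt ∷ Pp) Qq P·Q⇒R = AllP.++⁺ (AllP.map⁺ (All.map (P·Q⇒R Pt) Qq)) (All-*P Pp Qq P·Q⇒R)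

  -- Terms with zero coefficient may lie above E: ≈ is undecidable, so they cannot be pruned.
  TermBelow : ∀ {n} → Monomial F n → Term n → Set l
  TermBelow E t = proj₂ t ≤lex E ⊎ proj₁ t ≈ 0#

  IsLeadingMonomial : ∀ {n} → Monomial F n → Poly F n → Set (c ⊔ l)
  IsLeadingMonomial E p = ¬ coeff p E ≈ 0# × All (TermBelow E) p

  TermBelow-·ₜ : ∀ {n} {E G : Monomial F n} {t u} → TermBelow E t → TermBelow G u →
                 TermBelow (E ⊕ G) (t ·ₜ u)
  TermBelow-·ₜ (inj₁ e≤E) (inj₁ f≤G) = inj₁ (⊕-mono-≤lex e≤E f≤G)
  TermBelow-·ₜ (inj₂ a≈0) _          = inj₂ (x≈0⇒x*y≈0 a≈0)
  TermBelow-·ₜ (inj₁ _)   (inj₂ b≈0) = inj₂ (y≈0⇒x*y≈0 b≈0)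

  termCoeff-·ₜ : ∀ {n} {E G : Monomial F n} {t u} → TermBelow E t → TermBelow G u →
                 termCoeff (t ·ₜ u) (E ⊕ G) ≈ termCoeff t E * termCoeff u G
  termCoeff-·ₜ {E = E} {G} {a , e} {b , f} (inj₂ a≈0) _ =
    trans (termCoeff-≈0 (e ⊕ f) (E ⊕ G) (x≈0⇒x*y≈0 a≈0)) (sym (x≈0⇒x*y≈0 (termCoeff-≈0 e E a≈0)))
  termCoeff-·ₜ {E = E} {G} {a , e} {b , f} (inj₁ _) (inj₂ b≈0) =
    trans (termCoeff-≈0 (e ⊕ f) (E ⊕ G) (y≈0⇒x*y≈0 b≈0)) (sym (y≈0⇒x*y≈0 (termCoeff-≈0 f G b≈0)))
  termCoeff-·ₜ {E = E} {G} {a , e} {b , f} (inj₁ e≤E) (inj₁ f≤G) with e ≟ₘ E | f ≟ₘ G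
  ... | yes ≡.refl | yes ≡.refl = termCoeff-self (a * b) (e ⊕ f)
  ... | no e≢E     | _          =
    trans (termCoeff-≢ (a * b) (e ⊕ f) (E ⊕ G) (e≢E ∘ proj₁ ∘ ⊕-≤lex-cancel e≤E f≤G)) (sym (zeroˡ _))
  ... | yes _      | no f≢G     =
    trans (termCoeff-≢ (a * b) (e ⊕ f) (E ⊕ G) (f≢G ∘ proj₂ ∘ ⊕-≤lex-cancel e≤E f≤G)) (sym (zeroʳ _))

  coeff-map-·ₜ : ∀ {n} {E G : Monomial F n} {t q} → TermBelow E t → All (TermBelow G) q →
                 coeff (List.map (t ·ₜ_) q) (E ⊕ G) ≈ termCoeff t E * coeff q G
  coeff-map-·ₜ t≤E []          = sym (zeroʳ _)
  coeff-map-·ₜ t≤E (u≤G ∷ q≤G) =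
    trans (+-cong (termCoeff-·ₜ t≤E u≤G) (coeff-map-·ₜ t≤E q≤G)) (sym (distribˡ _ _ _))

  coeff-*P-≤lex : ∀ {n} {E G : Monomial F n} {p q} → All (TermBelow E) p → All (TermBelow G) q →
                  coeff (p *P q) (E ⊕ G) ≈ coeff p E * coeff q G
  coeff-*P-≤lex                     []          q≤G = sym (zeroˡ _)
  coeff-*P-≤lex {E = E} {G} {t ∷ p} {q} (t≤E ∷ p≤E) q≤G = begin
    coeff (List.map (t ·ₜ_) q ++ p *P q) (E ⊕ G)
      ≈⟨ coeff-++ (List.map (t ·ₜ_) q) (p *P q) (E ⊕ G) ⟩
    coeff (List.map (t ·ₜ_) q) (E ⊕ G) + coeff (p *P q) (E ⊕ G)
      ≈⟨ +-cong (coeff-map-·ₜ t≤E q≤G) (coeff-*P-≤lex p≤E q≤G) ⟩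
    termCoeff t E * coeff q G + coeff p E * coeff q G
      ≈⟨ distribʳ _ _ _ ⟨
    coeff (t ∷ p) E * coeff q G ∎

  *P-leading : ∀ {n} {E G : Monomial F n} {p q} → IsLeadingMonomial E p → IsLeadingMonomial G q →
               IsLeadingMonomial (E ⊕ G) (p *P q)
  *P-leading (p≉0 , p≤E) (q≉0 , q≤G) =
    (λ pq≈0 → x≉0∧y≉0⇒x*y≉0 p≉0 q≉0 (trans (sym (coeff-*P-≤lex p≤E q≤G)) pq≈0)) ,
    All-*P p≤E q≤G TermBelow-·ₜ

  1P-leading : ∀ {n} → IsLeadingMonomial (Vec.replicate n 0) 1P
  1P-leading {n} =
    (λ c≈0 → 0≉1 (trans (sym c≈0) (trans (+-identityʳ _) (termCoeff-self 1# (Vec.replicate n 0))))) ,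
    inj₁ (≤lex-refl _) ∷ []

  shift : ∀ {n} → Term n → Term (suc n)
  shift = map₂ (0 ∷_)

  coeff-shift : ∀ {n} (p : Poly F n) e → coeff (List.map shift p) (0 ∷ e) ≈ coeff p e
  coeff-shift []      e = refl
  coeff-shift (t ∷ p) e = +-congˡ (coeff-shift p e)

  TermBelow-shift : ∀ {n} {E : Monomial F n} {t} → TermBelow E t → TermBelow (0 ∷ E) (shift t)
  TermBelow-shift (inj₁ e≤E) = inj₁ (next ≡.refl e≤E)
  TermBelow-shift (inj₂ a≈0) = inj₂ a≈0

  -- linPoly a unfolds to linTerms a id.
  private
    unit : ∀ n → Fin n → Monomial F n
    unit n i = Vec.updateAt (Vec.replicate n 0) i (λ _ → 1)

    linTerms : ∀ {n k} → Vec Carrier k → (Fin k → Fin n) → Poly F n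
    linTerms a idx = Vec.toList (Vec.zipWith (λ aᵢ i → aᵢ , unit _ i) a (Vec.tabulate idx))

    linTerms-suc : ∀ {n k} (a : Vec Carrier k) (idx : Fin k → Fin n) →
                   linTerms a (Fin.suc ∘ idx) ≡ List.map shift (linTerms a idx)
    linTerms-suc []      idx = ≡.refl
    linTerms-suc (x ∷ a) idx = cong (_ ∷_) (linTerms-suc a (idx ∘ Fin.suc))

  linPoly-∷ : ∀ {n} x (a : Vec Carrier n) →
              linPoly (x ∷ a) ≡ (x , 1 ∷ Vec.replicate n 0) ∷ List.map shift (linPoly a)
  linPoly-∷ x a = cong (_ ∷_) (linTerms-suc a (λ i → i))

  linPoly-∷-leading-head : ∀ {n} {x} (a : Vec Carrier n) → ¬ x ≈ 0# →
                           IsLeadingMonomial (1 ∷ Vec.replicate n 0) (linPoly (x ∷ a))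
  linPoly-∷-leading-head {n} {x} a x≉0 =
    ≡.subst (IsLeadingMonomial _) (≡.sym (linPoly-∷ x a)) $
    (λ c≈0 → x≉0 (trans (sym coeff≈x) c≈0)) ,
    inj₁ (≤lex-refl _) ∷ AllP.map⁺ (All.universal (λ _ → inj₁ (this ℕ.z<s ≡.refl)) (linPoly a))
    where
    coeff≈x : termCoeff (x , 1 ∷ Vec.replicate n 0) (1 ∷ Vec.replicate n 0)
              + coeff (List.map shift (linPoly a)) (1 ∷ Vec.replicate n 0) ≈ x
    coeff≈x = trans (+-cong (termCoeff-self x (1 ∷ Vec.replicate n 0))
                            (coeff-absent _ (AllP.map⁺ (All.universal (λ _ ()) (linPoly a)))))
                    (+-identityʳ x)

  linPoly-∷-leading-tail : ∀ {n} {x} {E} (a : Vec Carrier n) → x ≈ 0# →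
                           IsLeadingMonomial E (linPoly a) → IsLeadingMonomial (0 ∷ E) (linPoly (x ∷ a))
  linPoly-∷-leading-tail {n} {x} {E} a x≈0 (c≉0 , a≤E) =
    ≡.subst (IsLeadingMonomial _) (≡.sym (linPoly-∷ x a)) $
    (λ c≈0 → c≉0 (trans (sym coeff≈) c≈0)) , inj₂ x≈0 ∷ AllP.map⁺ (All.map TermBelow-shift a≤E)
    where
    coeff≈ : termCoeff (x , 1 ∷ Vec.replicate n 0) (0 ∷ E) + coeff (List.map shift (linPoly a)) (0 ∷ E)
             ≈ coeff (linPoly a) E
    coeff≈ = trans (+-cong (termCoeff-≢ x (1 ∷ Vec.replicate n 0) (0 ∷ E) (λ ())) (coeff-shift (linPoly a) E))
                   (+-identityˡ _)

  -- The leading monomial of a linear form is xⱼ for the first j with a nonzero coefficient;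
  -- locating j needs x ≈ 0# to be decidable, hence the double negation.
  linPoly-leading : ∀ {n} (a : Vec Carrier n) → (∃ λ j → ¬ Vec.lookup a j ≈ 0#) →
                    ¬ ¬ (∃ λ E → IsLeadingMonomial E (linPoly a))
  linPoly-leading (x ∷ a) (j , aⱼ≉0) ∄lead = ¬¬-excluded-middle λ x≈0? → by-cases j aⱼ≉0 x≈0? ∄lead
    where
    by-cases : ∀ j → ¬ Vec.lookup (x ∷ a) j ≈ 0# → Dec (x ≈ 0#) →
               ¬ ¬ (∃ λ E → IsLeadingMonomial E (linPoly (x ∷ a)))
    by-cases _           _    (no x≉0)  = pure (_ , linPoly-∷-leading-head a x≉0)
    by-cases Fin.zero    x≉0  (yes x≈0) = contradiction x≈0 x≉0
    by-cases (Fin.suc j) aⱼ≉0 (yes x≈0) = do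
      E , lead ← linPoly-leading a (j , aⱼ≉0)
      pure (0 ∷ E , linPoly-∷-leading-tail a x≈0 lead)

  prodOver-leading : ∀ {n m} {f : Fin m → Poly F n} (S : Subset m) →
                     (∀ i → ¬ ¬ (∃ λ E → IsLeadingMonomial E (f i))) →
                     ¬ ¬ (∃ λ E → IsLeadingMonomial E (prodOver f S))
  prodOver-leading []            _    = pure (_ , 1P-leading)
  prodOver-leading (outside ∷ S) lead = prodOver-leading S (lead ∘ Fin.suc)
  prodOver-leading (inside ∷ S)  lead = do
    E , lead₀ ← lead Fin.zero
    G , lead₊ ← prodOver-leading S (lead ∘ Fin.suc)
    pure (E ⊕ G , *P-leading lead₀ lead₊)

  Homogeneous : ∀ {n} → ℕ → Poly F n → Set c
  Homogeneous d = All (λ t → deg (proj₂ t) ≡ d)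

  *P-homogeneous : ∀ {n d d′} {p q : Poly F n} → Homogeneous d p → Homogeneous d′ q →
                   Homogeneous (d ℕ.+ d′) (p *P q)
  *P-homogeneous hp hq = All-*P hp hq λ {t} {u} degt degu →
    ≡.trans (deg-⊕ (proj₂ t) (proj₂ u)) (cong₂ ℕ._+_ degt degu)

  *P-deg≥ : ∀ {n d} (p : Poly F n) {q} → Homogeneous d q → All (λ u → d ≤ deg (proj₂ u)) (p *P q)
  *P-deg≥ {d = d} p hq = All-*P {P = λ _ → Data.Unit.⊤} (All.universal _ p) hq λ {t} {u} _ degu →
    ≡.subst (d ≤_) (≡.sym (deg-⊕ (proj₂ t) (proj₂ u)))
            (≡.subst (ℕ._≤ deg (proj₂ t) ℕ.+ deg (proj₂ u)) degu (ℕP.m≤n+m _ _))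

  linPoly-homogeneous : ∀ {n} (a : Vec Carrier n) → Homogeneous 1 (linPoly a)
  linPoly-homogeneous []              = []
  linPoly-homogeneous {suc n} (x ∷ a) = ≡.subst (Homogeneous 1) (≡.sym (linPoly-∷ x a)) $
    cong suc (deg-0ⁿ n) ∷ AllP.map⁺ (linPoly-homogeneous a)

  prodOver-homogeneous : ∀ {n m} {f : Fin m → Poly F n} (S : Subset m) →
                         (∀ i → Homogeneous 1 (f i)) → Homogeneous ∣ S ∣ (prodOver f S)
  prodOver-homogeneous {n} []    _     = deg-0ⁿ n ∷ []
  prodOver-homogeneous (outside ∷ S) hom = prodOver-homogeneous S (hom ∘ Fin.suc)
  prodOver-homogeneous (inside ∷ S)  hom =
    *P-homogeneous (hom Fin.zero) (prodOver-homogeneous S (hom ∘ Fin.suc))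

  leading-deg : ∀ {n d} {E : Monomial F n} {p} → Homogeneous d p → IsLeadingMonomial E p → deg E ≡ d
  leading-deg {d = d} {E} {p} hom (c≉0 , _) = decidable-stable (deg E ℕ.≟ d) λ degE≢d →
    c≉0 (coeff-absent p (All.map (λ degt≡d t≡E → degE≢d (≡.trans (cong deg (≡.sym t≡E)) degt≡d)) hom))

  homogeneous-≉P-higher : ∀ {n d} {E : Monomial F n} {p q} → Homogeneous d p → IsLeadingMonomial E p →
                          All (λ u → d < deg (proj₂ u)) q → ¬ p ≈P q
  homogeneous-≉P-higher {n} {d} {E} {q = q} hom lead q-higher p≈q =
    proj₁ lead (trans (p≈q E) (coeff-absent q (All.map (λ {u} → E-absent {u}) q-higher)))
    where
    E-absent : ∀ {u : Term n} → d < deg (proj₂ u) → proj₂ u ≢ E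
    E-absent d<deg u≡E = ℕP.<-irrefl (≡.trans (≡.sym (leading-deg hom lead)) (cong deg (≡.sym u≡E))) d<deg

  evalTerm : ∀ {n} → Term n → Vec Carrier n → Carrier
  evalTerm (a , e) v = a * evalMono e v

  powK-+ : ∀ x i j → Defs.powK F x (i ℕ.+ j) ≈ Defs.powK F x i * Defs.powK F x j
  powK-+ x zero    j = sym (*-identityˡ _)
  powK-+ x (suc i) j = trans (*-congˡ (powK-+ x i j)) (sym (*-assoc _ _ _))

  evalMono-⊕ : ∀ {n} (e f : Monomial F n) v → evalMono (e ⊕ f) v ≈ evalMono e v * evalMono f v
  evalMono-⊕ []      []      []      = sym (*-identityˡ _)
  evalMono-⊕ (i ∷ e) (j ∷ f) (x ∷ v) =
    trans (*-cong (powK-+ x i j) (evalMono-⊕ e f v)) (*-interchange _ _ _ _)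

  evalTerm-·ₜ : ∀ {n} (t u : Term n) v → evalTerm (t ·ₜ u) v ≈ evalTerm t v * evalTerm u v
  evalTerm-·ₜ (a , e) (b , f) v = trans (*-congˡ (evalMono-⊕ e f v)) (*-interchange _ _ _ _)

  eval-++ : ∀ {n} (p q : Poly F n) v → eval (p ++ q) v ≈ eval p v + eval q v
  eval-++ []      q v = sym (+-identityˡ _)
  eval-++ (t ∷ p) q v = trans (+-congˡ (eval-++ p q v)) (sym (+-assoc _ _ _))

  eval-map-·ₜ : ∀ {n} t (q : Poly F n) v → eval (List.map (t ·ₜ_) q) v ≈ evalTerm t v * eval q v
  eval-map-·ₜ t []      v = sym (zeroʳ _)
  eval-map-·ₜ t (u ∷ q) v =
    trans (+-cong (evalTerm-·ₜ t u v) (eval-map-·ₜ t q v)) (sym (distribˡ _ _ _))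

  eval-*P : ∀ {n} (p q : Poly F n) v → eval (p *P q) v ≈ eval p v * eval q v
  eval-*P []      q v = sym (zeroˡ _)
  eval-*P (t ∷ p) q v = begin
    eval (List.map (t ·ₜ_) q ++ p *P q) v             ≈⟨ eval-++ (List.map (t ·ₜ_) q) (p *P q) v ⟩
    eval (List.map (t ·ₜ_) q) v + eval (p *P q) v     ≈⟨ +-cong (eval-map-·ₜ t q v) (eval-*P p q v) ⟩
    evalTerm t v * eval q v + eval p v * eval q v     ≈⟨ distribʳ _ _ _ ⟨
    eval (t ∷ p) v * eval q v                         ∎

  evalMono-0ⁿ : ∀ {n} (v : Vec Carrier n) → evalMono (Vec.replicate n 0) v ≈ 1#
  evalMono-0ⁿ []      = refl
  evalMono-0ⁿ (y ∷ v) = trans (*-identityˡ _) (evalMono-0ⁿ v)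

  eval-shift : ∀ {n} (p : Poly F n) y v → eval (List.map shift p) (y ∷ v) ≈ eval p v
  eval-shift []      y v = refl
  eval-shift (t ∷ p) y v = +-cong (*-congˡ (*-identityˡ _)) (eval-shift p y v)

  eval-linPoly : ∀ {n} (a v : Vec Carrier n) → eval (linPoly a) v ≈ Defs.dot F a v
  eval-linPoly []      []      = refl
  eval-linPoly (x ∷ a) (y ∷ v) = begin
    eval (linPoly (x ∷ a)) (y ∷ v)
      ≡⟨ cong (λ p → eval p (y ∷ v)) (linPoly-∷ x a) ⟩
    x * ((y * 1#) * evalMono (Vec.replicate _ 0) v) + eval (List.map shift (linPoly a)) (y ∷ v)
      ≈⟨ +-cong (*-congˡ (trans (*-cong (*-identityʳ y) (evalMono-0ⁿ v)) (*-identityʳ y)))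
                (trans (eval-shift (linPoly a) y v) (eval-linPoly a v)) ⟩
    x * y + Defs.dot F a v
      ∎

  prodOver-vanishes : ∀ {n m} {f : Fin m → Poly F n} {S i} v → i ∈ S → eval (f i) v ≈ 0# →
                      eval (prodOver f S) v ≈ 0#
  prodOver-vanishes {f = f} {inside ∷ S} v here fᵢ≈0 =
    trans (eval-*P (f Fin.zero) _ v) (x≈0⇒x*y≈0 fᵢ≈0)
  prodOver-vanishes {f = f} {inside ∷ S} v (there i∈S) fᵢ≈0 =
    trans (eval-*P (f Fin.zero) _ v) (y≈0⇒x*y≈0 (prodOver-vanishes v i∈S fᵢ≈0))
  prodOver-vanishes {S = outside ∷ S} v (there i∈S) fᵢ≈0 = prodOver-vanishes v i∈S fᵢ≈0

  combination : ∀ {n m} → (Subset m → Poly F n) → List (Poly F n × Subset m) → Poly F n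
  combination g = List.foldr (λ t acc → proj₁ t *P g (proj₂ t) ++ acc) []

  combination-deg> : ∀ {n m k} {g : Subset m → Poly F n} → (∀ T → Homogeneous ∣ T ∣ (g T)) →
                     ∀ cs → All (λ t → k < ∣ proj₂ t ∣) cs → All (λ u → k < deg (proj₂ u)) (combination g cs)
  combination-deg> hom []             []             = []
  combination-deg> hom ((p , T) ∷ cs) (k<∣T∣ ∷ k<cs) =
    AllP.++⁺ (All.map (ℕP.<-≤-trans k<∣T∣) (*P-deg≥ p (hom T))) (combination-deg> hom cs k<cs)

module Hyperplanes {c l : Level} (F : Field c l) {n m : ℕ} (ℓ : Fin m → Vec (Field.Carrier F) n) where
  open Field F using (_≈_; 0#; trans)
  open Polynomials F
  open Arr F ℓ
  open ListMembership using () renaming (_∈_ to _∈L_)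

  formProduct : Subset m → Poly F n
  formProduct = prodOver (λ i → linPoly (ℓ i))

  formProduct-homogeneous : ∀ S → Homogeneous ∣ S ∣ (formProduct S)
  formProduct-homogeneous S = prodOver-homogeneous S (λ i → linPoly-homogeneous (ℓ i))

  formProduct-vanishes : ∀ {𝒜 S} → Intersecting 𝒜 S → InVanishingIdeal 𝒜 (formProduct S)
  formProduct-vanishes S-meets a a∈𝒜 v v∈a with S-meets a a∈𝒜
  ... | i , i∈S , i∈a = prodOver-vanishes v i∈S (trans (eval-linPoly (ℓ i) v) (v∈a i i∈a))

  formProduct-≉P-higher : (∀ i → ∃ λ j → ¬ Vec.lookup (ℓ i) j ≈ 0#) →
                          ∀ S cs → All (λ t → ∣ S ∣ < ∣ proj₂ t ∣) cs →
                          ¬ formProduct S ≈P combination formProduct cs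
  formProduct-≉P-higher ℓ≉0 S cs larger S≈cs =
    prodOver-leading S (λ i → linPoly-leading (ℓ i) (ℓ≉0 i)) λ (E , lead) →
      homogeneous-≉P-higher (formProduct-homogeneous S) lead
        (combination-deg> formProduct-homogeneous cs larger) S≈cs

  intersecting? : ∀ 𝒜 → Decidable (Intersecting 𝒜)
  intersecting? 𝒜 S = map′ (λ meets _ → All.lookup meets) (λ meets → All.tabulate (meets _))
                           (All.all? (λ a → any? (λ i → i ∈? S ×-dec i ∈? a)) 𝒜)

  ⊤-intersecting : ∀ {𝒜} → (∀ a → a ∈L 𝒜 → ¬ IsBottom a) → Intersecting 𝒜 ⊤
  ⊤-intersecting nonBottom a a∈𝒜 with any? (_∈? a)
  ... | yes (i , i∈a) = i , ∈⊤ , i∈a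
  ... | no ∄i         = contradiction (λ v i i∈a → contradiction (i , i∈a) ∄i) (nonBottom a a∈𝒜)

  small-blocker⇒turan : ∀ {𝒜 S T} → IsSmallest (Intersecting 𝒜) S → InBlocker 𝒜 T → ∣ T ∣ ≤ ∣ S ∣ → Turan 𝒜
  small-blocker⇒turan {S = S} {T} (S-meets , S-min) T-blocker ∣T∣≤∣S∣ =
    ∣ S ∣ , ((S , S-meets , ≡.refl) , S-min) ,
            ((T , T-blocker , ℕP.≤-antisym ∣T∣≤∣S∣ (S-min T (proj₁ (proj₂ T-blocker)))) ,
             λ T′ T′-blocker → S-min T′ (proj₁ (proj₂ T′-blocker)))

  formProduct∈blockerIdeal⇒turan : ∀ {𝒜 S} → (∀ i → ∃ λ j → ¬ Vec.lookup (ℓ i) j ≈ 0#) →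
                                   IsSmallest (Intersecting 𝒜) S → InBlockerIdeal 𝒜 (formProduct S) → Turan 𝒜
  formProduct∈blockerIdeal⇒turan {S = S} ℓ≉0 S-smallest (cs , cs-blockers , S≈cs)
    with All.all? (λ t → ∣ S ∣ ℕ.<? ∣ proj₂ t ∣) cs
  ... | yes larger = contradiction S≈cs (formProduct-≉P-higher ℓ≉0 S cs larger)
  ... | no ¬larger with All.lookupAny cs-blockers (AllP.¬All⇒Any¬ (λ t → ∣ S ∣ ℕ.<? ∣ proj₂ t ∣) cs ¬larger)
  ...   | T-blocker , ∣S∣≮∣T∣ = small-blocker⇒turan S-smallest T-blocker (ℕP.≮⇒≥ ∣S∣≮∣T∣)

theorem5p2 : ∀ {c l : Level} (F : Field c l) (n m : ℕ)
               (ℓ : Fin m → Vec (Field.Carrier F) n) →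
               Arr.IsArrangement F ℓ →
               (𝒜 : List (Subset m)) →
               Arr.IsAntichain F ℓ 𝒜 →
               Arr.BlockerIdealEqVanishing F ℓ 𝒜 →
               Arr.Turan F ℓ 𝒜
theorem5p2 F n m ℓ (ℓ≉0 , _) 𝒜 (_ , _ , nonBottom , _) 𝓑≡𝓘 =
  formProduct∈blockerIdeal⇒turan ℓ≉0 S-smallest
    (proj₂ (𝓑≡𝓘 (formProduct S)) (formProduct-vanishes (proj₁ S-smallest)))
  where
  open Hyperplanes F ℓ
  minimum : ∃ (IsSmallest (Arr.Intersecting F ℓ 𝒜))
  minimum = smallest (intersecting? 𝒜) (⊤-intersecting nonBottom)
  S : Subset m
  S = proj₁ minimum
  S-smallest : IsSmallest (Arr.Intersecting F ℓ 𝒜) S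
  S-smallest = proj₂ minimum
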